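{- Let $\Phi_t$ be a type derivation in system $\mathcal{V}$ with subject $t$, let $r$ be a redex occurrence of $t$ with $r\in\mathrm{toc}(\Phi_t)$, and let $\rho:\Phi_t\rightarrow_\beta^*\Phi_{t'}$ be a reduction sequence of derivations such that $\Phi_{t'}$ is normal. Then $r$ is used in $\rho$ (i.e. $\rho$ contracts $r$ or some residual of $r$).
   Context: Pure $\lambda$-terms; occurrences are words over $\{0,1\}$ ($0$: function part/abstraction body, $1$: argument); redex occurrences $p$ with $t|_p=(\lambda x.s)u$; residuals are the standard descendants ($\emptyset$ if $p\in\{r,r0\}$; $\{p\}$ if $r$ not a prefix of $p$; $\{rq\}$ if $p=r00q$; $\{rkq\mid s|_k=x\}$ if $p=r1q$, where $t|_r=(\lambda x.s)u$). System $\mathcal{V}$: types $\tau::=\mathtt{a}\mid\alpha\mid\mathcal{M}\to\tau$; rules (ax) $x:[\tau]\vdash x:\tau$; (val) $\emptyset\vdash\lambda x.t:\mathtt{a}$; ($\to$i) from $\Gamma\vdash t:\tau$ infer $\Gamma\setminus x\vdash\lambda x.t:\Gamma(x)\to\tau$; ($\to$e) from $\Gamma\vdash t:[\sigma_i]_{i\in I}\to\tau$ and $(\Delta_i\vdash u:\sigma_i)_{i\in I}$ infer $\Gamma+\sum_i\Delta_i\vdash t\,u:\tau$. Typed occurrences $\mathrm{toc}(\Phi)$: $\{\epsilon\}$ for (ax),(val); $\{\epsilon\}\cup0\cdot\mathrm{toc}(\Phi_t)$ for ($\to$i); $\{\epsilon\}\cup0\cdot\mathrm{toc}(\Phi_t)\cup\bigcup_i1\cdot\mathrm{toc}(\Phi_u^i)$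 for ($\to$e). A derivation $\Phi$ with subject $t$ is normal if no redex occurrence of $t$ belongs to $\mathrm{toc}(\Phi)$. Reduction of derivations: if $\Phi$ has subject $t$, $t\rightarrow_\beta t'$ contracting $r$, and $m$ is the longest prefix of $r$ in $\mathrm{toc}(\Phi)$, then $\Phi\rightarrow_\beta\Phi'$ where every subderivation at $m$ is rewritten: if $m=r$, the ($\to$e) with left premise ($\to$i) on $\lambda x.s$ (premise $\Phi_s$) and argument premises $(\Phi_u^i)$ is replaced by a typed substitution of $x$ by $(\Phi_u^i)$ in $\Phi_s$ (axioms on $x$ replaced by $\Phi_u^i$ of matching type, distributed nondeterministically; $u$ substituted for $x$ in untyped parts); otherwise only the subject is reduced. -}

module Defs where

open import Data.Nat using (ℕ; zero; suc; _<ᵇ_; _≡ᵇ_; pred)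
open import Data.Bool using (Bool; true; false; if_then_else_)
open import Data.List using (List; []; _∷_; _++_; map; concat)
open import Data.List.Relation.Unary.All using (All)
open import Data.List.Relation.Unary.Any using (Any)
open import Data.List.Relation.Binary.Pointwise using (Pointwise)
open import Data.List.Relation.Binary.Permutation.Propositional using (_↭_)
open import Data.Maybe using (Maybe; just; nothing)
open import Data.Product using (Σ; ∃; ∃₂; _×_; _,_)
open import Relation.Nullary using (¬_)
open import Relation.Binary.PropositionalEquality using (_≡_)

-- Pure λ-terms (de Bruijn indices; var n refers to the n-th enclosing λ)

data Term : Set where
  var : ℕ → Term
  lam : Term → Term
  app : Term → Term → Term

data Dir : Set where
  d0 d1 : Dir

Pos : Set
Pos = List Dir

_at_ : Term → Pos → Maybe Term
t         at []       = just t
lam t     at (d0 ∷ p) = t at p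
app t u   at (d0 ∷ p) = t at p
app t u   at (d1 ∷ p) = u at p
_         at _        = nothing

IsRedex : Term → Pos → Set
IsRedex t r = ∃₂ λ s u → t at r ≡ just (app (lam s) u)

shift : ℕ → Term → Term
shift c (var x)   = if x <ᵇ c then var x else var (suc x)
shift c (lam t)   = lam (shift (suc c) t)
shift c (app t u) = app (shift c t) (shift c u)

subst : ℕ → Term → Term → Term
subst k u (var x)   =
  if x <ᵇ k then var x else (if x ≡ᵇ k then u else var (pred x))
subst k u (lam t)   = lam (subst (suc k) (shift 0 u) t)
subst k u (app t v) = app (subst k u t) (subst k u v)

data StepAt : Term → Pos → Term → Set where
  beta : ∀ {s u} → StepAt (app (lam s) u) [] (subst 0 u s)
  lamS : ∀ {t p t'} → StepAt t p t' → StepAt (lam t) (d0 ∷ p) (lam t')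
  appL : ∀ {t u p t'} → StepAt t p t' → StepAt (app t u) (d0 ∷ p) (app t' u)
  appR : ∀ {t u p u'} → StepAt u p u' → StepAt (app t u) (d1 ∷ p) (app t u')

-- VarOcc s n k : k is an occurrence in s of the variable which is free
-- with index n at the root of s (i.e. of x, when n = 0 and s is the body of λx.s)
data VarOcc : Term → ℕ → Pos → Set where
  here : ∀ {n} → VarOcc (var n) n []
  lamV : ∀ {t n k} → VarOcc t (suc n) k → VarOcc (lam t) n (d0 ∷ k)
  appL : ∀ {t u n k} → VarOcc t n k → VarOcc (app t u) n (d0 ∷ k)
  appR : ∀ {t u n k} → VarOcc u n k → VarOcc (app t u) n (d1 ∷ k)

-- Res t r p p' : p' is a residual of p after contracting the redex r of t
-- (no constructor for p ∈ {r, r0}: then there is no residual)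
data Res (t : Term) (r : Pos) : Pos → Pos → Set where
  outside : ∀ {p} → ¬ (∃ λ q → p ≡ r ++ q) → Res t r p p
  body    : ∀ {q} → Res t r (r ++ d0 ∷ d0 ∷ q) (r ++ q)
  arg     : ∀ {s u q k} → t at r ≡ just (app (lam s) u) → VarOcc s 0 k →
            Res t r (r ++ d1 ∷ q) (r ++ k ++ q)

-- Types of system V; multisets are lists taken up to permutation

data Ty : Set where
  atom : Ty
  tvar : ℕ → Ty
  _⇒_  : List Ty → Ty → Ty

-- equality of types (multisets compared up to permutation)
mutual
  data _≈T_ : Ty → Ty → Set where
    atom : atom ≈T atom
    tvar : ∀ n → tvar n ≈T tvar n
    arr  : ∀ {Ms Ns τ σ} → Ms ≈M Ns → τ ≈T σ → (Ms ⇒ τ) ≈T (Ns ⇒ σ)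

  data _≈M_ : List Ty → List Ty → Set where
    []   : [] ≈M []
    cons : ∀ {τ σ Ms Ns₁ Ns₂} → τ ≈T σ → Ms ≈M (Ns₁ ++ Ns₂) →
           (τ ∷ Ms) ≈M (Ns₁ ++ σ ∷ Ns₂)

-- (Raw) derivation trees of system V.
--   ax x τ        : (ax)   x : [τ] ⊢ x : τ
--   val t         : (val)  ∅ ⊢ λ.t : a
--   abs Φ         : (→i)   from Φ (body)
--   app Φ u Ψs    : (→e)   Φ for the function, argument term u, premises Ψs for u

data Der : Set where
  ax  : ℕ → Ty → Der
  val : Term → Der
  abs : Der → Der
  app : Der → Term → List Der → Der

subj : Der → Term
subj (ax x τ)     = var x
subj (val t)      = lam t
subj (abs Φ)      = lam (subj Φ)
subj (app Φ u Ψs) = app (subj Φ) u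

-- Γ(x) where x is the variable with index k: the multiset (as a list) of types
-- of the axioms on that variable (contexts add up in (→e))
mutual
  ctxAt : ℕ → Der → List Ty
  ctxAt k (ax x τ)     = if x ≡ᵇ k then τ ∷ [] else []
  ctxAt k (val t)      = []
  ctxAt k (abs Φ)      = ctxAt (suc k) Φ
  ctxAt k (app Φ u Ψs) = ctxAt k Φ ++ ctxAts k Ψs

  ctxAts : ℕ → List Der → List Ty
  ctxAts k []       = []
  ctxAts k (Ψ ∷ Ψs) = ctxAt k Ψ ++ ctxAts k Ψs

cod : Ty → Ty
cod (Ms ⇒ τ) = τ
cod _        = atom

ty : Der → Ty
ty (ax x τ)     = τ
ty (val t)      = atom
ty (abs Φ)      = ctxAt 0 Φ ⇒ ty Φ
ty (app Φ u Ψs) = cod (ty Φ)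

data Valid : Der → Set where
  ax  : ∀ {x τ} → Valid (ax x τ)
  val : ∀ {t} → Valid (val t)
  abs : ∀ {Φ} → Valid Φ → Valid (abs Φ)
  app : ∀ {Φ u Ψs Ms τ} → Valid Φ → ty Φ ≡ (Ms ⇒ τ) → Ms ≈M map ty Ψs →
        All (λ Ψ → Valid Ψ × subj Ψ ≡ u) Ψs → Valid (app Φ u Ψs)

data InToc : Pos → Der → Set where
  here : ∀ {Φ} → InToc [] Φ
  absT : ∀ {p Φ} → InToc p Φ → InToc (d0 ∷ p) (abs Φ)
  appL : ∀ {p Φ u Ψs} → InToc p Φ → InToc (d0 ∷ p) (app Φ u Ψs)
  appR : ∀ {p Φ u Ψs} → Any (InToc p) Ψs → InToc (d1 ∷ p) (app Φ u Ψs)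

Normal : Der → Set
Normal Φ = ∀ p → IsRedex (subj Φ) p → ¬ InToc p Φ

mutual
  shiftD : ℕ → Der → Der
  shiftD c (ax x τ)     = ax (if x <ᵇ c then x else suc x) τ
  shiftD c (val t)      = val (shift (suc c) t)
  shiftD c (abs Φ)      = abs (shiftD (suc c) Φ)
  shiftD c (app Φ u Ψs) = app (shiftD c Φ) (shift c u) (shiftDs c Ψs)

  shiftDs : ℕ → List Der → List Der
  shiftDs c []       = []
  shiftDs c (Ψ ∷ Ψs) = shiftD c Ψ ∷ shiftDs c Ψs

-- TSubst k u Φ Ψs Φ' : Φ' is a typed substitution in Φ of the variable with
-- index k by the derivations Ψs (of subject u), each axiom on the variable being
-- replaced by a derivation of matching type, the Ψs being distributed
-- (nondeterministically) among these axioms; u is substituted in untyped parts.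
mutual
  data TSubst : ℕ → Term → Der → List Der → Der → Set where
    axHit  : ∀ {k u τ Ψ} → ty Ψ ≈T τ → TSubst k u (ax k τ) (Ψ ∷ []) Ψ
    axMiss : ∀ {k u x τ} → (x ≡ᵇ k) ≡ false →
             TSubst k u (ax x τ) [] (ax (if x <ᵇ k then x else pred x) τ)
    valS   : ∀ {k u t} → TSubst k u (val t) [] (val (subst (suc k) (shift 0 u) t))
    absS   : ∀ {k u Φ Ψs Φ'} → TSubst (suc k) (shift 0 u) Φ (shiftDs 0 Ψs) Φ' →
             TSubst k u (abs Φ) Ψs (abs Φ')
    appS   : ∀ {k u Φ v Χs Ψs Ψs₀ Ψss Φ' Χs'} →
             Ψs ↭ (Ψs₀ ++ concat Ψss) →
             TSubst k u Φ Ψs₀ Φ' →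
             TSubsts k u Χs Ψss Χs' →
             TSubst k u (app Φ v Χs) Ψs (app Φ' (subst k u v) Χs')

  data TSubsts : ℕ → Term → List Der → List (List Der) → List Der → Set where
    []  : ∀ {k u} → TSubsts k u [] [] []
    _∷_ : ∀ {k u Χ Χs Ψs Ψss Χ' Χs'} → TSubst k u Χ Ψs Χ' →
          TSubsts k u Χs Ψss Χs' → TSubsts k u (Χ ∷ Χs) (Ψs ∷ Ψss) (Χ' ∷ Χs')

-- One walks down r while it stays in toc(Φ); at the longest prefix m:
--   m = r   : typed substitution (rule betaD);
--   m ≠ r   : only the subject is reduced (rules valD, and appR with no premises).
-- Every subderivation at m (each argument premise) is rewritten (Pointwise).
data DStep : Der → Pos → Der → Set where
  betaD : ∀ {Φs u Ψs Φ'} → TSubst 0 u Φs Ψs Φ' →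
          DStep (app (abs Φs) u Ψs) [] Φ'
  valD  : ∀ {t p t'} → StepAt t p t' → DStep (val t) (d0 ∷ p) (val t')
  absD  : ∀ {Φ p Φ'} → DStep Φ p Φ' → DStep (abs Φ) (d0 ∷ p) (abs Φ')
  appLD : ∀ {Φ u Ψs p Φ'} → DStep Φ p Φ' → DStep (app Φ u Ψs) (d0 ∷ p) (app Φ' u Ψs)
  appRD : ∀ {Φ u Ψs p u' Ψs'} → StepAt u p u' →
          Pointwise (λ Ψ Ψ' → DStep Ψ p Ψ') Ψs Ψs' →
          DStep (app Φ u Ψs) (d1 ∷ p) (app Φ u' Ψs')

data Red : Der → Der → Set where
  done : ∀ {Φ} → Red Φ Φ
  step : ∀ {Φ Φ' Φ''} (r : Pos) → DStep Φ r Φ' → Red Φ' Φ'' → Red Φ Φ''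

data Uses : ∀ {Φ Φ''} → Pos → Red Φ Φ'' → Set where
  now   : ∀ {Φ Φ' Φ'' r} {s : DStep Φ r Φ'} {ρ : Red Φ' Φ''} →
          Uses r (step r s ρ)
  later : ∀ {Φ Φ' Φ'' r p p'} {s : DStep Φ r Φ'} {ρ : Red Φ' Φ''} →
          Res (subj Φ) r p p' → Uses p' ρ → Uses p (step r s ρ)

module Submission where

-- A typed redex occurrence that is not contracted by a step of derivations has a residual
-- which is again a typed redex occurrence of the reduct: outside the contracted redex nothing
-- moves, inside its body the typed part survives the typed substitution, and a typed redex
-- of an argument premise is grafted by the substitution onto an axiom of the bound variable,
-- i.e. onto one of the occurrences where the argument gets copied. Along a reduction
-- sequence this yields a chain of typed residuals of r, which cannot reach a normal
-- derivation unless one of them is contracted.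

open import Defs
open import Data.Nat using (zero; suc; _<ᵇ_; _≡ᵇ_; pred)
open import Data.Bool using (true; false; if_then_else_)
open import Data.List using ([]; _∷_; _++_)
open import Data.List.Properties using (≡-dec)
open import Data.List.Relation.Unary.All using (All; []; _∷_)
open import Data.List.Relation.Unary.Any using (Any; here; there)
open import Data.List.Relation.Binary.Pointwise using (Pointwise; []; _∷_)
open import Data.List.Relation.Binary.Permutation.Propositional.Properties using (Any-resp-↭; All-resp-↭)
import Data.List.Relation.Unary.Any.Properties as Any
import Data.List.Relation.Unary.All.Properties as All
open import Data.Product using (∃; _×_; _,_; proj₁; proj₂)
open import Data.Sum using (inj₁; inj₂)
open import Data.Empty using (⊥-elim)
open import Relation.Nullary using (yes; no)
open import Relation.Binary.Definitions using (DecidableEquality)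
open import Relation.Binary.PropositionalEquality
  using (_≡_; _≢_; refl; sym; trans; cong) renaming (subst to transport)

-- The untyped part of Valid: it is all the argument needs, and unlike Valid it is
-- evidently preserved by DStep, which never re-checks types.
data Coherent : Der → Set where
  ax  : ∀ {x τ} → Coherent (ax x τ)
  val : ∀ {t} → Coherent (val t)
  abs : ∀ {Φ} → Coherent Φ → Coherent (abs Φ)
  app : ∀ {Φ u Ψs} → Coherent Φ → All (λ Ψ → Coherent Ψ × subj Ψ ≡ u) Ψs →
        Coherent (app Φ u Ψs)

CoherentPremise : Term → Der → Set
CoherentPremise u Ψ = Coherent Ψ × subj Ψ ≡ u

TypedRedex : Pos → Der → Set
TypedRedex p Φ = InToc p Φ × IsRedex (subj Φ) p

mutual
  Valid⇒Coherent : ∀ {Φ} → Valid Φ → Coherent Φ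
  Valid⇒Coherent ax              = ax
  Valid⇒Coherent val             = val
  Valid⇒Coherent (abs v)         = abs (Valid⇒Coherent v)
  Valid⇒Coherent (app v _ _ vs)  = app (Valid⇒Coherent v) (Valid⇒CoherentPremises vs)

  Valid⇒CoherentPremises : ∀ {u Ψs} → All (λ Ψ → Valid Ψ × subj Ψ ≡ u) Ψs →
                           All (CoherentPremise u) Ψs
  Valid⇒CoherentPremises []             = []
  Valid⇒CoherentPremises ((v , e) ∷ vs) = (Valid⇒Coherent v , e) ∷ Valid⇒CoherentPremises vs

<ᵇ-irrefl : ∀ k → (k <ᵇ k) ≡ false
<ᵇ-irrefl zero    = refl
<ᵇ-irrefl (suc k) = <ᵇ-irrefl k

≡ᵇ-refl : ∀ k → (k ≡ᵇ k) ≡ true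
≡ᵇ-refl zero    = refl
≡ᵇ-refl (suc k) = ≡ᵇ-refl k

subst-var-hit : ∀ k u → subst k u (var k) ≡ u
subst-var-hit k u rewrite <ᵇ-irrefl k | ≡ᵇ-refl k = refl

subst-var-miss : ∀ x k u → (x ≡ᵇ k) ≡ false →
                 subst k u (var x) ≡ var (if x <ᵇ k then x else pred x)
subst-var-miss x k u x≢k with x <ᵇ k
... | true  = refl
... | false rewrite x≢k = refl

IsRedex-shift : ∀ c t q → IsRedex t q → IsRedex (shift c t) q
IsRedex-shift c t         []       (_ , _ , refl) = _ , _ , refl
IsRedex-shift c (lam t)   (d0 ∷ q) r = IsRedex-shift (suc c) t q r
IsRedex-shift c (app t u) (d0 ∷ q) r = IsRedex-shift c t q r
IsRedex-shift c (app t u) (d1 ∷ q) r = IsRedex-shift c u q r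
IsRedex-shift c (var x)   (_ ∷ q)  (_ , _ , ())
IsRedex-shift c (lam t)   (d1 ∷ q) (_ , _ , ())

IsRedex-subst : ∀ k u t q → IsRedex t q → IsRedex (subst k u t) q
IsRedex-subst k u t         []       (_ , _ , refl) = _ , _ , refl
IsRedex-subst k u (lam t)   (d0 ∷ q) r = IsRedex-subst (suc k) (shift 0 u) t q r
IsRedex-subst k u (app t w) (d0 ∷ q) r = IsRedex-subst k u t q r
IsRedex-subst k u (app t w) (d1 ∷ q) r = IsRedex-subst k u w q r
IsRedex-subst k u (var x)   (_ ∷ q)  (_ , _ , ())
IsRedex-subst k u (lam t)   (d1 ∷ q) (_ , _ , ())

IsRedex-root-stepFun : ∀ {t p t' u} → StepAt t p t' →
                       IsRedex (app t u) [] → IsRedex (app t' u) []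
IsRedex-root-stepFun (lamS _) (_ , _ , refl) = _ , _ , refl

IsRedex-root-changeArg : ∀ {t u u'} → IsRedex (app t u) [] → IsRedex (app t u') []
IsRedex-root-changeArg (_ , _ , refl) = _ , _ , refl

StepAt-deterministic : ∀ {t p t₁ t₂} → StepAt t p t₁ → StepAt t p t₂ → t₁ ≡ t₂
StepAt-deterministic beta     beta     = refl
StepAt-deterministic (lamS s) (lamS s') = cong lam (StepAt-deterministic s s')
StepAt-deterministic (appL s) (appL s') = cong (λ t → app t _) (StepAt-deterministic s s')
StepAt-deterministic (appR s) (appR s') = cong (app _) (StepAt-deterministic s s')

subj-shiftD : ∀ c Φ → subj (shiftD c Φ) ≡ shift c (subj Φ)
subj-shiftD c (ax x τ) with x <ᵇ c
... | true  = refl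
... | false = refl
subj-shiftD c (val t)      = refl
subj-shiftD c (abs Φ)      = cong lam (subj-shiftD (suc c) Φ)
subj-shiftD c (app Φ u Ψs) = cong (λ t → app t (shift c u)) (subj-shiftD c Φ)

mutual
  Coherent-shiftD : ∀ c {Φ} → Coherent Φ → Coherent (shiftD c Φ)
  Coherent-shiftD c ax         = ax
  Coherent-shiftD c val        = val
  Coherent-shiftD c (abs h)    = abs (Coherent-shiftD (suc c) h)
  Coherent-shiftD c (app h hs) = app (Coherent-shiftD c h) (CoherentPremises-shiftDs c hs)

  CoherentPremises-shiftDs : ∀ c {u Ψs} → All (CoherentPremise u) Ψs →
                             All (CoherentPremise (shift c u)) (shiftDs c Ψs)
  CoherentPremises-shiftDs c [] = []
  CoherentPremises-shiftDs c {Ψs = Ψ ∷ _} ((h , e) ∷ hs) =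
    (Coherent-shiftD c h , trans (subj-shiftD c Ψ) (cong (shift c) e))
      ∷ CoherentPremises-shiftDs c hs

mutual
  InToc-shiftD : ∀ c {p Φ} → InToc p Φ → InToc p (shiftD c Φ)
  InToc-shiftD c here     = here
  InToc-shiftD c (absT i) = absT (InToc-shiftD (suc c) i)
  InToc-shiftD c (appL i) = appL (InToc-shiftD c i)
  InToc-shiftD c (appR i) = appR (InToc-shiftDs c i)

  InToc-shiftDs : ∀ c {p Ψs} → Any (InToc p) Ψs → Any (InToc p) (shiftDs c Ψs)
  InToc-shiftDs c (here i)  = here (InToc-shiftD c i)
  InToc-shiftDs c (there i) = there (InToc-shiftDs c i)

TypedRedex-shiftDs : ∀ c {p Ψs} → Any (TypedRedex p) Ψs → Any (TypedRedex p) (shiftDs c Ψs)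
TypedRedex-shiftDs c {p} {Ψ ∷ _} (here (i , r)) =
  here (InToc-shiftD c i ,
        transport (λ t → IsRedex t p) (sym (subj-shiftD c Ψ)) (IsRedex-shift c (subj Ψ) p r))
TypedRedex-shiftDs c (there rs) = there (TypedRedex-shiftDs c rs)

mutual
  TSubst-coherent : ∀ {k u Φ Ψs Φ'} → TSubst k u Φ Ψs Φ' → Coherent Φ →
                    All (CoherentPremise u) Ψs → Coherent Φ' × subj Φ' ≡ subst k u (subj Φ)
  TSubst-coherent {k} {u} (axHit _) ax ((h , e) ∷ []) = h , trans e (sym (subst-var-hit k u))
  TSubst-coherent {k} {u} (axMiss {x = x} x≢k) ax [] = ax , sym (subst-var-miss x k u x≢k)
  TSubst-coherent valS val [] = val , refl
  TSubst-coherent (absS σ) (abs h) hs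
    with TSubst-coherent σ h (CoherentPremises-shiftDs 0 hs)
  ... | h' , e = abs h' , cong lam e
  TSubst-coherent (appS {Ψs₀ = Ψs₀} Ψs↭ σ σs) (app h gs) hs
    with All.++⁻ Ψs₀ (All-resp-↭ Ψs↭ hs)
  ... | hs₀ , hss with TSubst-coherent σ h hs₀
  ... | h' , e = app h' (TSubsts-coherent σs gs (All.concat⁻ hss)) , cong (λ t → app t _) e

  TSubsts-coherent : ∀ {k u v Χs Ψss Χs'} → TSubsts k u Χs Ψss Χs' →
                     All (CoherentPremise v) Χs → All (All (CoherentPremise u)) Ψss →
                     All (CoherentPremise (subst k u v)) Χs'
  TSubsts-coherent [] [] [] = []
  TSubsts-coherent (σ ∷ σs) ((g , e) ∷ gs) (hs ∷ hss) with TSubst-coherent σ g hs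
  ... | g' , e' = (g' , trans e' (cong (subst _ _) e)) ∷ TSubsts-coherent σs gs hss

mutual
  TSubst-InToc : ∀ {k u Φ Ψs Φ' p} → TSubst k u Φ Ψs Φ' → InToc p Φ → InToc p Φ'
  TSubst-InToc _              here     = here
  TSubst-InToc (absS σ)       (absT i) = absT (TSubst-InToc σ i)
  TSubst-InToc (appS _ σ _)   (appL i) = appL (TSubst-InToc σ i)
  TSubst-InToc (appS _ _ σs)  (appR i) = appR (TSubsts-InToc σs i)

  TSubsts-InToc : ∀ {k u Χs Ψss Χs' p} → TSubsts k u Χs Ψss Χs' →
                  Any (InToc p) Χs → Any (InToc p) Χs'
  TSubsts-InToc (σ ∷ _)  (here i)  = here (TSubst-InToc σ i)
  TSubsts-InToc (_ ∷ σs) (there i) = there (TSubsts-InToc σs i)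

mutual
  TSubst-graft : ∀ {k u Φ Ψs Φ' q} → TSubst k u Φ Ψs Φ' → Coherent Φ →
                 All (CoherentPremise u) Ψs → Any (TypedRedex q) Ψs →
                 ∃ λ j → VarOcc (subj Φ) k j × TypedRedex (j ++ q) Φ'
  TSubst-graft (axHit _) ax _ (here r)  = [] , here , r
  TSubst-graft (axHit _) ax _ (there ())
  TSubst-graft (axMiss _) _ _ ()
  TSubst-graft valS _ _ ()
  TSubst-graft (absS σ) (abs h) hs rs
    with TSubst-graft σ h (CoherentPremises-shiftDs 0 hs) (TypedRedex-shiftDs 0 rs)
  ... | j , o , i , r = d0 ∷ j , lamV o , absT i , r
  TSubst-graft (appS {Ψs₀ = Ψs₀} {Ψss = Ψss} Ψs↭ σ σs) (app h gs) hs rs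
    with All.++⁻ Ψs₀ (All-resp-↭ Ψs↭ hs) | Any.++⁻ Ψs₀ (Any-resp-↭ Ψs↭ rs)
  ... | hs₀ , _ | inj₁ rs₀ with TSubst-graft σ h hs₀ rs₀
  ...   | j , o , i , r = d0 ∷ j , appL o , appL i , r
  TSubst-graft (appS {Ψs₀ = Ψs₀} {Ψss = Ψss} Ψs↭ σ σs) (app h gs) hs rs
      | _ , hss | inj₂ rss with TSubsts-graft σs gs (All.concat⁻ hss) (Any.concat⁻ Ψss rss)
  ...   | j , o , i , r = d1 ∷ j , appR o , appR i , r

  TSubsts-graft : ∀ {k u v Χs Ψss Χs' q} → TSubsts k u Χs Ψss Χs' →
                  All (CoherentPremise v) Χs → All (All (CoherentPremise u)) Ψss →
                  Any (Any (TypedRedex q)) Ψss →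
                  ∃ λ j → VarOcc v k j × Any (InToc (j ++ q)) Χs' × IsRedex (subst k u v) (j ++ q)
  TSubsts-graft {q = q} (σ ∷ _) ((g , e) ∷ _) (hs ∷ _) (here rs)
    with TSubst-graft σ g hs rs | TSubst-coherent σ g hs
  ... | j , o , i , r | _ , e' =
    j , transport (λ t → VarOcc t _ j) e o , here i ,
    transport (λ t → IsRedex t (j ++ q)) (trans e' (cong (subst _ _) e)) r
  TSubsts-graft (_ ∷ σs) (_ ∷ gs) (_ ∷ hss) (there rss) with TSubsts-graft σs gs hss rss
  ... | j , o , i , r = j , o , there i , r

mutual
  DStep-coherent : ∀ {Φ r Φ'} → DStep Φ r Φ' → Coherent Φ →
                   Coherent Φ' × StepAt (subj Φ) r (subj Φ')
  DStep-coherent (betaD σ) (app (abs h) hs) with TSubst-coherent σ h hs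
  ... | h' , e = h' , transport (StepAt _ []) (sym e) beta
  DStep-coherent (valD s) val = val , lamS s
  DStep-coherent (absD δ) (abs h) with DStep-coherent δ h
  ... | h' , s = abs h' , lamS s
  DStep-coherent (appLD δ) (app h hs) with DStep-coherent δ h
  ... | h' , s = app h' hs , appL s
  DStep-coherent (appRD s δs) (app h hs) = app h (DSteps-coherent δs hs s) , appR s

  DSteps-coherent : ∀ {p u u' Ψs Ψs'} → Pointwise (λ Ψ Ψ' → DStep Ψ p Ψ') Ψs Ψs' →
                    All (CoherentPremise u) Ψs → StepAt u p u' → All (CoherentPremise u') Ψs'
  DSteps-coherent [] [] _ = []
  DSteps-coherent (δ ∷ δs) ((h , e) ∷ hs) s with DStep-coherent δ h
  ... | h' , s' =
    (h' , StepAt-deterministic (transport (λ t → StepAt t _ _) e s') s) ∷ DSteps-coherent δs hs s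

Res-cons : ∀ {t t' d r p p'} → (∀ q → t' at (d ∷ q) ≡ t at q) →
           Res t r p p' → Res t' (d ∷ r) (d ∷ p) (d ∷ p')
Res-cons _   (outside p∉r) = outside λ { (q , refl) → p∉r (q , refl) }
Res-cons _   body          = body
Res-cons sub (arg e o)     = arg (trans (sub _) e) o

TypedRedex-premise : ∀ {u q Ψs} → All (CoherentPremise u) Ψs → IsRedex u q →
                     Any (InToc q) Ψs → Any (TypedRedex q) Ψs
TypedRedex-premise {q = q} ((_ , e) ∷ _) r (here i) =
  here (i , transport (λ t → IsRedex t q) (sym e) r)
TypedRedex-premise (_ ∷ hs) r (there i) = there (TypedRedex-premise hs r i)

mutual
  typedResidual : ∀ {Φ r Φ' p} → DStep Φ r Φ' → Coherent Φ → TypedRedex p Φ → p ≢ r →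
                  ∃ λ p' → Res (subj Φ) r p p' × TypedRedex p' Φ'
  typedResidual (betaD σ) _ (here , _) p≢r = ⊥-elim (p≢r refl)
  typedResidual (betaD σ) _ (appL here , (_ , _ , ())) _
  typedResidual (betaD {Φs = Φs} {u = u} σ) (app (abs h) hs) (appL (absT {p = q} i) , r) _
    with TSubst-coherent σ h hs
  ... | _ , e =
    q , body , TSubst-InToc σ i ,
    transport (λ t → IsRedex t q) (sym e) (IsRedex-subst 0 u (subj Φs) q r)
  typedResidual (betaD σ) (app (abs h) hs) (appR {p = q} i , r) _
    with TSubst-graft σ h hs (TypedRedex-premise hs r i)
  ... | j , o , r' = j ++ q , arg refl o , r'
  typedResidual (valD _) _ (here , (_ , _ , ())) _
  typedResidual (absD _) _ (here , (_ , _ , ())) _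
  typedResidual (absD δ) (abs h) (absT i , r) p≢r
    with typedResidual δ h (i , r) (λ { refl → p≢r refl })
  ... | p' , res , i' , r' = d0 ∷ p' , Res-cons (λ _ → refl) res , absT i' , r'
  typedResidual (appLD δ) (app h _) (here , r) _ =
    [] , outside (λ { (_ , ()) }) , here , IsRedex-root-stepFun (proj₂ (DStep-coherent δ h)) r
  typedResidual (appLD δ) (app h _) (appL i , r) p≢r
    with typedResidual δ h (i , r) (λ { refl → p≢r refl })
  ... | p' , res , i' , r' = d0 ∷ p' , Res-cons (λ _ → refl) res , appL i' , r'
  typedResidual (appLD _) _ (appR {p = q} i , r) _ = d1 ∷ q , outside (λ { (_ , ()) }) , appR i , r
  typedResidual (appRD _ _) _ (here , r) _ = [] , outside (λ { (_ , ()) }) , here , IsRedex-root-changeArg r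
  typedResidual (appRD _ _) _ (appL {p = q} i , r) _ = d0 ∷ q , outside (λ { (_ , ()) }) , appL i , r
  typedResidual (appRD s δs) (app _ hs) (appR i , r) p≢r
    with typedResidual-premises δs hs s r i (λ { refl → p≢r refl })
  ... | q' , res , i' , r' = d1 ∷ q' , Res-cons (λ _ → refl) res , appR i' , r'

  typedResidual-premises : ∀ {p u u' Ψs Ψs' q} → Pointwise (λ Ψ Ψ' → DStep Ψ p Ψ') Ψs Ψs' →
                           All (CoherentPremise u) Ψs → StepAt u p u' → IsRedex u q →
                           Any (InToc q) Ψs → q ≢ p →
                           ∃ λ q' → Res u p q q' × Any (InToc q') Ψs' × IsRedex u' q'
  typedResidual-premises {p = p} {q = q} (δ ∷ _) ((h , e) ∷ _) s r (here i) q≢p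
    with typedResidual δ h (i , transport (λ t → IsRedex t q) (sym e) r) q≢p | DStep-coherent δ h
  ... | q' , res , i' , r' | _ , s' =
    q' , transport (λ t → Res t p q q') e res , here i' ,
    transport (λ t → IsRedex t q') (StepAt-deterministic (transport (λ t → StepAt t p _) e s') s) r'
  typedResidual-premises (_ ∷ δs) (_ ∷ hs) s r (there i) q≢p
    with typedResidual-premises δs hs s r i q≢p
  ... | q' , res , i' , r' = q' , res , there i' , r'

_≟Dir_ : DecidableEquality Dir
d0 ≟Dir d0 = yes refl
d0 ≟Dir d1 = no λ ()
d1 ≟Dir d0 = no λ ()
d1 ≟Dir d1 = yes refl

_≟Pos_ : DecidableEquality Pos
_≟Pos_ = ≡-dec _≟Dir_

typedRedex-used : ∀ {Φ Φ'} (r : Pos) → Coherent Φ → TypedRedex r Φ →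
                  (ρ : Red Φ Φ') → Normal Φ' → Uses r ρ
typedRedex-used r _ (i , rd) done nf = ⊥-elim (nf r rd i)
typedRedex-used r h tr (step r' δ ρ) nf with r ≟Pos r'
... | yes refl = now
... | no r≢r' with typedResidual δ h tr r≢r'
... | r'' , res , tr' = later res (typedRedex-used r'' (proj₁ (DStep-coherent δ h)) tr' ρ nf)

mainTheorem12 : (Φ Φ' : Der) (r : Pos) → Valid Φ → IsRedex (subj Φ) r → InToc r Φ →
                (ρ : Red Φ Φ') → Normal Φ' → Uses r ρ
mainTheorem12 Φ Φ' r v rd i ρ nf = typedRedex-used r (Valid⇒Coherent v) (i , rd) ρ nf
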